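{- Let $\mathcal{T}$ be a finite derivation of $\mathrm{labCS}^\infty$ (a finite tree of sequents built from rule instances, possibly with open leaves). Any label phase applied to $\mathcal{T}$ terminates and yields a finite tree whose open leaves are label saturated.
   Context: Formulas: $A::=\bot\mid p\mid A\to A\mid\Box A\mid\triangle A$ over a countable set $\mathtt{Prop}$ of atoms. Fix a countable set of labels. A labelled formula is $x:A$; a relational atom is $xRy$ or $xSy$. A sequent $\mathcal{R},\Gamma\Rightarrow\Omega$ consists of a finite multiset $\mathcal{R}$ of relational atoms and finite multisets $\Gamma,\Omega$ of labelled formulas. The rules $\Box$R and $\triangle$R of $\mathrm{labCS}^\infty$ are: ($\Box$R) from premiss $\mathcal{R},xRy,\Gamma\Rightarrow y:A,\Omega$ infer $\mathcal{R},\Gamma\Rightarrow x:\Box A,\Omega$, where $y$ does not occur in the conclusion; ($\triangle$R) from premiss $\mathcal{R},xSy,\Gamma\Rightarrow y:A,\Omega$ infer $\mathcal{R},\Gamma\Rightarrow x:\triangle A,\Omega$, where $y$ does not occur in the conclusion. A derivation is a tree of sequents each of whose nodes with its children is a rule instance of $\mathrm{labCS}^\infty$, except that some leaves (open leaves) need not be conclusions of premiss-free rules. A label phase consists of applying (bottom-up) the rules $\Box$R and $\triangle$R to open leaves as long as possible. A sequent is label saturated if neither $\Box$R nor $\triangle$R can be applied to it, i.e. its right-hand side contains no labelled formula of the form $x:\Box A$ or $x:\triangle A$. -}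

module Defs where

open import Data.Nat using (ℕ)
open import Data.Product using (Σ; ∃; ∃-syntax; _×_; _,_)
open import Data.Sum using (_⊎_)
open import Data.List using (List; []; _∷_; map)
open import Data.List.Relation.Unary.All using (All)
open import Data.List.Membership.Propositional using (_∈_)
open import Data.List.Relation.Binary.Permutation.Propositional using (_↭_)
open import Relation.Nullary using (¬_)

data Formula : Set where
  ⊥'   : Formula
  atom : ℕ → Formula
  _⇒_  : Formula → Formula → Formula
  □_   : Formula → Formula
  △_   : Formula → Formula

Label : Set
Label = ℕ

LFormula : Set
LFormula = Label × Formula

data RelAtom : Set where
  R⟨_,_⟩ : Label → Label → RelAtom
  S⟨_,_⟩ : Label → Label → RelAtom

-- Sequent  𝓡, Γ ⇒ Ω ; finite multisets represented by lists
-- (rule instances are taken up to permutation, i.e. as multisets)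
record Sequent : Set where
  constructor seq
  field
    rels  : List RelAtom
    left  : List LFormula
    right : List LFormula
open Sequent public

data OccursRel (y : Label) : RelAtom → Set where
  R₁ : ∀ {z} → OccursRel y R⟨ y , z ⟩
  R₂ : ∀ {z} → OccursRel y R⟨ z , y ⟩
  S₁ : ∀ {z} → OccursRel y S⟨ y , z ⟩
  S₂ : ∀ {z} → OccursRel y S⟨ z , y ⟩

Occurs : Label → Sequent → Set
Occurs y (seq 𝓡 Γ Ω) =
  (∃[ r ] (r ∈ 𝓡 × OccursRel y r))
  ⊎ (∃[ A ] ((y , A) ∈ Γ))
  ⊎ (∃[ A ] ((y , A) ∈ Ω))

BoxR : Sequent → Sequent → Set
BoxR c p = ∃[ x ] ∃[ y ] ∃[ A ] ∃[ Ω ]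
  ( right c ↭ ((x , □ A) ∷ Ω)
  × rels p ↭ (R⟨ x , y ⟩ ∷ rels c)
  × left p ↭ left c
  × right p ↭ ((y , A) ∷ Ω)
  × ¬ Occurs y c )

TriR : Sequent → Sequent → Set
TriR c p = ∃[ x ] ∃[ y ] ∃[ A ] ∃[ Ω ]
  ( right c ↭ ((x , △ A) ∷ Ω)
  × rels p ↭ (S⟨ x , y ⟩ ∷ rels c)
  × left p ↭ left c
  × right p ↭ ((y , A) ∷ Ω)
  × ¬ Occurs y c )

data Tree : Set where
  open-leaf : Sequent → Tree
  node      : Sequent → List Tree → Tree

root : Tree → Sequent
root (open-leaf s) = s
root (node s _)    = s

-- Derivation w.r.t. a rule set `Rule` (rule instances: conclusion, list of premisses)
data IsDeriv (Rule : Sequent → List Sequent → Set) : Tree → Set where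
  open-ok : ∀ {s} → IsDeriv Rule (open-leaf s)
  node-ok : ∀ {s ts} → Rule s (map root ts) → All (IsDeriv Rule) ts →
            IsDeriv Rule (node s ts)

LabelSaturated : Sequent → Set
LabelSaturated s =
  (∀ x A → ¬ ((x , □ A) ∈ right s)) × (∀ x A → ¬ ((x , △ A) ∈ right s))

data OpenLeavesSaturated : Tree → Set where
  leaf-sat : ∀ {s} → LabelSaturated s → OpenLeavesSaturated (open-leaf s)
  node-sat : ∀ {s ts} → All OpenLeavesSaturated ts → OpenLeavesSaturated (node s ts)

mutual
  data LStep : Tree → Tree → Set where
    boxR-step : ∀ {s p} → BoxR s p → LStep (open-leaf s) (node s (open-leaf p ∷ []))
    triR-step : ∀ {s p} → TriR s p → LStep (open-leaf s) (node s (open-leaf p ∷ []))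
    inside    : ∀ {s ts ts'} → LStepList ts ts' → LStep (node s ts) (node s ts')

  data LStepList : List Tree → List Tree → Set where
    here  : ∀ {t t' ts} → LStep t t' → LStepList (t ∷ ts) (t' ∷ ts)
    there : ∀ {t ts ts'} → LStepList ts ts' → LStepList (t ∷ ts) (t ∷ ts')

Stuck : Tree → Set
Stuck t = ∀ t' → ¬ LStep t t'

{-# OPTIONS --safe #-}
-- A label phase only ever replaces a principal formula x:□A or x:△A on the
-- right of an open leaf by y:A, so the total size of the right-hand sides of
-- the open leaves strictly decreases: every label phase terminates.  Each step
-- is an instance of □R or △R (the fresh eigenvariable is available because a
-- sequent has only finitely many labels), so derivations stay derivations, and
-- an open leaf at which no step applies has no boxed or triangled formula on
-- its right, i.e. it is label saturated.
module Submission where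

open import Defs
open import Data.Product using (_×_; _,_; proj₁; proj₂; ∃-syntax)
open import Data.Sum using (inj₁; inj₂)
open import Data.List using (List; []; _∷_; _++_; [_]; map; concatMap)
open import Data.List.Relation.Unary.All as All using (All; []; _∷_)
open import Data.List.Relation.Unary.Any as Any using (here; there)
open import Data.List.Membership.Propositional using (_∈_)
open import Data.List.Membership.Propositional.Properties
  using (∈-∃++; ∈-map⁺; ∈-++⁺ˡ; ∈-++⁺ʳ; ∈-concatMap⁺)
open import Data.List.Relation.Binary.Permutation.Propositional using (_↭_; ↭-refl)
open import Data.List.Relation.Binary.Permutation.Propositional.Properties
  using (shift; map⁺)
open import Data.List.Extrema.Nat using (max; xs≤max)
open import Data.Nat using (ℕ; suc; _+_; _<_)
open import Data.Nat.Properties using (≤-refl; +-identityʳ; +-monoˡ-<; +-monoʳ-<; 1+n≰n)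
open import Data.Nat.ListAction using (sum)
open import Data.Nat.ListAction.Properties using (sum-↭)
open import Data.Nat.Induction using (<-wellFounded)
open import Function using (_∘_; flip)
open import Induction.WellFounded using (Acc; module Subrelation)
import Relation.Binary.Construct.On as On
open import Relation.Binary.Construct.Closure.ReflexiveTransitive using (Star; ε; _◅_)
open import Relation.Binary.PropositionalEquality using (_≡_; refl; cong)
open import Relation.Nullary using (¬_)

size : Formula → ℕ
size ⊥'      = 0
size (atom _) = 0
size (A ⇒ B) = suc (size A + size B)
size (□ A)   = suc (size A)
size (△ A)   = suc (size A)

weight : List LFormula → ℕ
weight = sum ∘ map (size ∘ proj₂)

weight-↭ : ∀ {Γ Δ} → Γ ↭ Δ → weight Γ ≡ weight Δ
weight-↭ = sum-↭ ∘ map⁺ (size ∘ proj₂)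

weight-<-↭ : ∀ {Γ Δ Ω x y A B} → size A < size B →
             Γ ↭ (y , A) ∷ Ω → Δ ↭ (x , B) ∷ Ω → weight Γ < weight Δ
weight-<-↭ {Ω = Ω} A<B Γ↭ Δ↭ rewrite weight-↭ Γ↭ | weight-↭ Δ↭ =
  +-monoˡ-< (weight Ω) A<B

BoxR-weight : ∀ {c p} → BoxR c p → weight (right p) < weight (right c)
BoxR-weight (_ , _ , _ , _ , c↭ , _ , _ , p↭ , _) = weight-<-↭ ≤-refl p↭ c↭

TriR-weight : ∀ {c p} → TriR c p → weight (right p) < weight (right c)
TriR-weight (_ , _ , _ , _ , c↭ , _ , _ , p↭ , _) = weight-<-↭ ≤-refl p↭ c↭

mutual
  pending : Tree → ℕ
  pending (open-leaf s) = weight (right s)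
  pending (node _ ts)   = pendingAll ts

  pendingAll : List Tree → ℕ
  pendingAll []       = 0
  pendingAll (t ∷ ts) = pending t + pendingAll ts

mutual
  LStep-pending : ∀ {t t'} → LStep t t' → pending t' < pending t
  LStep-pending (boxR-step {p = p} r) rewrite +-identityʳ (weight (right p)) = BoxR-weight r
  LStep-pending (triR-step {p = p} r) rewrite +-identityʳ (weight (right p)) = TriR-weight r
  LStep-pending (inside steps) = LStepList-pendingAll steps

  LStepList-pendingAll : ∀ {ts ts'} → LStepList ts ts' → pendingAll ts' < pendingAll ts
  LStepList-pendingAll {_ ∷ ts} (here step)  = +-monoˡ-< (pendingAll ts) (LStep-pending step)
  LStepList-pendingAll {t ∷ _}  (there steps) = +-monoʳ-< (pending t) (LStepList-pendingAll steps)

LStep-accessible : ∀ t → Acc (flip LStep) t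
LStep-accessible t =
  Subrelation.accessible LStep-pending (On.accessible pending (<-wellFounded (pending t)))

LStep-root : ∀ {t t'} → LStep t t' → root t ≡ root t'
LStep-root (boxR-step _) = refl
LStep-root (triR-step _) = refl
LStep-root (inside _)    = refl

LStepList-roots : ∀ {ts ts'} → LStepList ts ts' → map root ts ≡ map root ts'
LStepList-roots (here step)       = cong (_∷ _) (LStep-root step)
LStepList-roots (there {t} steps) = cong (root t ∷_) (LStepList-roots steps)

module _ {Rule : Sequent → List Sequent → Set}
         (BoxR⇒Rule : ∀ c p → BoxR c p → Rule c [ p ])
         (TriR⇒Rule : ∀ c p → TriR c p → Rule c [ p ]) where

  mutual
    LStep-IsDeriv : ∀ {t t'} → LStep t t' → IsDeriv Rule t → IsDeriv Rule t'
    LStep-IsDeriv (boxR-step {s} {p} r) _ = node-ok (BoxR⇒Rule s p r) (open-ok ∷ [])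
    LStep-IsDeriv (triR-step {s} {p} r) _ = node-ok (TriR⇒Rule s p r) (open-ok ∷ [])
    LStep-IsDeriv (inside steps) (node-ok r ds) rewrite LStepList-roots steps =
      node-ok r (LStepList-IsDeriv steps ds)

    LStepList-IsDeriv : ∀ {ts ts'} → LStepList ts ts' →
                        All (IsDeriv Rule) ts → All (IsDeriv Rule) ts'
    LStepList-IsDeriv (here step)   (d ∷ ds) = LStep-IsDeriv step d ∷ ds
    LStepList-IsDeriv (there steps) (d ∷ ds) = d ∷ LStepList-IsDeriv steps ds

  Star-IsDeriv : ∀ {t t'} → Star LStep t t' → IsDeriv Rule t → IsDeriv Rule t'
  Star-IsDeriv ε              d = d
  Star-IsDeriv (step ◅ steps) d = Star-IsDeriv steps (LStep-IsDeriv step d)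

relLabels : RelAtom → List Label
relLabels R⟨ x , y ⟩ = x ∷ y ∷ []
relLabels S⟨ x , y ⟩ = x ∷ y ∷ []

labels : Sequent → List Label
labels (seq 𝓡 Γ Ω) = concatMap relLabels 𝓡 ++ map proj₁ Γ ++ map proj₁ Ω

OccursRel⇒∈relLabels : ∀ {y r} → OccursRel y r → y ∈ relLabels r
OccursRel⇒∈relLabels R₁ = here refl
OccursRel⇒∈relLabels R₂ = there (here refl)
OccursRel⇒∈relLabels S₁ = here refl
OccursRel⇒∈relLabels S₂ = there (here refl)

Occurs⇒∈labels : ∀ {y} s → Occurs y s → y ∈ labels s
Occurs⇒∈labels (seq 𝓡 Γ Ω) (inj₁ (_ , r∈𝓡 , occ)) =
  ∈-++⁺ˡ (∈-concatMap⁺ relLabels (Any.map (λ { refl → OccursRel⇒∈relLabels occ }) r∈𝓡))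
Occurs⇒∈labels (seq 𝓡 Γ Ω) (inj₂ (inj₁ (_ , yA∈Γ))) =
  ∈-++⁺ʳ (concatMap relLabels 𝓡) (∈-++⁺ˡ (∈-map⁺ proj₁ yA∈Γ))
Occurs⇒∈labels (seq 𝓡 Γ Ω) (inj₂ (inj₂ (_ , yA∈Ω))) =
  ∈-++⁺ʳ (concatMap relLabels 𝓡) (∈-++⁺ʳ (map proj₁ Γ) (∈-map⁺ proj₁ yA∈Ω))

freshLabel : Sequent → Label
freshLabel s = suc (max 0 (labels s))

freshLabel-¬Occurs : ∀ s → ¬ Occurs (freshLabel s) s
freshLabel-¬Occurs s occ = 1+n≰n (All.lookup (xs≤max 0 (labels s)) (Occurs⇒∈labels s occ))

∈⇒↭∷ : ∀ {v : LFormula} {xs} → v ∈ xs → ∃[ ys ] xs ↭ v ∷ ys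
∈⇒↭∷ {v} v∈xs with ys , zs , refl ← ∈-∃++ v∈xs = ys ++ zs , shift v ys zs

BoxR-applicable : ∀ {s x A} → (x , □ A) ∈ right s → ∃[ p ] BoxR s p
BoxR-applicable {s} {x} {A} x□A∈ with Ω , s↭ ← ∈⇒↭∷ x□A∈ =
  seq (R⟨ x , y ⟩ ∷ rels s) (left s) ((y , A) ∷ Ω) ,
  x , y , A , Ω , s↭ , ↭-refl , ↭-refl , ↭-refl , freshLabel-¬Occurs s
  where y = freshLabel s

TriR-applicable : ∀ {s x A} → (x , △ A) ∈ right s → ∃[ p ] TriR s p
TriR-applicable {s} {x} {A} x△A∈ with Ω , s↭ ← ∈⇒↭∷ x△A∈ =
  seq (S⟨ x , y ⟩ ∷ rels s) (left s) ((y , A) ∷ Ω) ,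
  x , y , A , Ω , s↭ , ↭-refl , ↭-refl , ↭-refl , freshLabel-¬Occurs s
  where y = freshLabel s

mutual
  Stuck⇒OpenLeavesSaturated : ∀ t → Stuck t → OpenLeavesSaturated t
  Stuck⇒OpenLeavesSaturated (open-leaf s) stuck = leaf-sat (no-□ , no-△)
    where
    no-□ : ∀ x A → ¬ (x , □ A) ∈ right s
    no-□ _ _ x□A∈ = stuck _ (boxR-step (proj₂ (BoxR-applicable x□A∈)))
    no-△ : ∀ x A → ¬ (x , △ A) ∈ right s
    no-△ _ _ x△A∈ = stuck _ (triR-step (proj₂ (TriR-applicable x△A∈)))
  Stuck⇒OpenLeavesSaturated (node s ts) stuck =
    node-sat (StuckAll⇒OpenLeavesSaturated ts (λ _ steps → stuck _ (inside steps)))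

  StuckAll⇒OpenLeavesSaturated : ∀ ts → (∀ ts' → ¬ LStepList ts ts') →
                                  All OpenLeavesSaturated ts
  StuckAll⇒OpenLeavesSaturated []       _     = []
  StuckAll⇒OpenLeavesSaturated (t ∷ ts) stuck =
    Stuck⇒OpenLeavesSaturated t (λ _ step → stuck _ (here step))
    ∷ StuckAll⇒OpenLeavesSaturated ts (λ _ steps → stuck _ (there steps))

lemma3 : (Rule : Sequent → List Sequent → Set) →
         (∀ c p → BoxR c p → Rule c (p ∷ [])) →
         (∀ c p → TriR c p → Rule c (p ∷ [])) →
         (T : Tree) → IsDeriv Rule T →
         Acc (λ t' t → LStep t t') T
         × (∀ T' → Star LStep T T' → Stuck T' →
            IsDeriv Rule T' × OpenLeavesSaturated T')
lemma3 Rule BoxR⇒Rule TriR⇒Rule T d =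
  LStep-accessible T ,
  λ T' steps stuck → Star-IsDeriv BoxR⇒Rule TriR⇒Rule steps d
                   , Stuck⇒OpenLeavesSaturated T' stuck
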